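{- Let $T$ be a rooted tree with nonnegative real node weights, let $K \ge 1$, and let $S$ be a summary tree of $T$ with $k \le K$ nodes. For every node $v$ of $T$ such that $S$ contains a group node $other_v$, the number of children of $v$ represented by $other_v$ is at least $d_v - K + 2$, where $d_v$ is the number of children of $v$ in $T$.
   Context: For a node $v$ of $T$, $T_v$ denotes the subtree rooted at $v$ and $V(T_v)$ its node set. Summary trees are trees whose nodes are labeled by sets of nodes of $T$, defined recursively. If $T_v$ has one node, the only summary tree for $T_v$ is the single node $\{v\}$. Otherwise a summary tree for $T_v$ is one of: (1) the one-node tree $V(T_v)$; (2) a root $\{v\}$ together with, for each child $x$ of $v$, a summary tree for $T_x$ whose root is made a child of $\{v\}$; (3) a root $\{v\}$, a child node $other_v$ representing a non-empty subset $U_v$ of the children of $v$ together with all their descendants (the node $\bigcup_{x\in U_v} V(T_x)$), and for each child $x\notin U_v$ of $v$ a summary tree for $T_x$ whose root is made a child of $\{v\}$. A summary tree of $T$ is a summary tree for $T_r$, $r$ the root of $T$. -}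

module Defs where

open import Data.Nat using (ℕ; zero; suc; _+_)
open import Data.List using (List; []; _∷_; length)

data Tree : Set where
  node : List Tree → Tree

children : Tree → List Tree
children (node ts) = ts

degree : Tree → ℕ
degree t = length (children t)

mutual
  data Pos : Tree → Set where
    here  : ∀ {t} → Pos t
    child : ∀ {ts} → ChildPos ts → Pos (node ts)

  data ChildPos : List Tree → Set where
    hd : ∀ {t ts} → Pos t → ChildPos (t ∷ ts)
    tl : ∀ {t ts} → ChildPos ts → ChildPos (t ∷ ts)

mutual
  subtreeAt : ∀ {t} → Pos t → Tree
  subtreeAt {t} here = t
  subtreeAt (child cp) = subtreeAtC cp

  subtreeAtC : ∀ {ts} → ChildPos ts → Tree
  subtreeAtC (hd p) = subtreeAt p
  subtreeAtC (tl cp) = subtreeAtC cp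

-- Summary trees for T_v, following the recursive definition.
--  * collapse : case (1), the one-node tree V(T_v) (only for trees with >1 node;
--               for a one-node tree the unique summary tree {v} is  expand [] ).
--  * expand   : case (2), root {v} with a summary tree for each child.
--  * group    : case (3), root {v}, a node other_v for a nonempty subset U_v of the
--               children, and summary trees for the remaining children.
--               Choices ts m : for each child, either "in U_v" (other) or a summary
--               tree (own); m = |U_v|, required to be ≥ 1.
mutual
  data Summary : Tree → Set where
    collapse : ∀ {t ts} → Summary (node (t ∷ ts))
    expand   : ∀ {ts} → Subs ts → Summary (node ts)
    group    : ∀ {ts m} → Choices ts (suc m) → Summary (node ts)

  data Subs : List Tree → Set where
    []  : Subs []
    _∷_ : ∀ {t ts} → Summary t → Subs ts → Subs (t ∷ ts)

  data Choices : List Tree → ℕ → Set where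
    []    : Choices [] zero
    other : ∀ {t ts m} → Choices ts m → Choices (t ∷ ts) (suc m)
    own   : ∀ {t ts m} → Summary t → Choices ts m → Choices (t ∷ ts) m

mutual
  size : ∀ {t} → Summary t → ℕ
  size collapse = 1
  size (expand ss) = suc (sizeS ss)
  size (group cs) = suc (suc (sizeC cs))

  sizeS : ∀ {ts} → Subs ts → ℕ
  sizeS [] = 0
  sizeS (s ∷ ss) = size s + sizeS ss

  sizeC : ∀ {ts m} → Choices ts m → ℕ
  sizeC [] = 0
  sizeC (other cs) = sizeC cs
  sizeC (own s cs) = size s + sizeC cs

-- HasOther S p m : the summary tree S contains a group node other_v, where v is
-- the node of T at position p, and other_v represents exactly m children of v.
mutual
  data HasOther : ∀ {t} → Summary t → Pos t → ℕ → Set where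
    at-root   : ∀ {ts m} {cs : Choices ts (suc m)} →
                HasOther (group cs) here (suc m)
    in-expand : ∀ {ts m} {ss : Subs ts} {cp : ChildPos ts} →
                SubsHas ss cp m → HasOther (expand ss) (child cp) m
    in-group  : ∀ {ts n m} {cs : Choices ts (suc n)} {cp : ChildPos ts} →
                ChoicesHas cs cp m → HasOther (group cs) (child cp) m

  data SubsHas : ∀ {ts} → Subs ts → ChildPos ts → ℕ → Set where
    hd : ∀ {t ts m} {s : Summary t} {ss : Subs ts} {p : Pos t} →
         HasOther s p m → SubsHas (s ∷ ss) (hd p) m
    tl : ∀ {t ts m} {s : Summary t} {ss : Subs ts} {cp : ChildPos ts} →
         SubsHas ss cp m → SubsHas (s ∷ ss) (tl cp) m

  data ChoicesHas : ∀ {ts n} → Choices ts n → ChildPos ts → ℕ → Set where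
    hd-own   : ∀ {t ts n m} {s : Summary t} {cs : Choices ts n} {p : Pos t} →
               HasOther s p m → ChoicesHas (own s cs) (hd p) m
    tl-other : ∀ {t ts n m} {cs : Choices ts n} {cp : ChildPos ts} →
               ChoicesHas cs cp m → ChoicesHas (other {t = t} cs) (tl cp) m
    tl-own   : ∀ {t ts n m} {s : Summary t} {cs : Choices ts n} {cp : ChildPos ts} →
               ChoicesHas cs cp m → ChoicesHas (own s cs) (tl cp) m

-- If S contains other_v representing m of the d_v children of v, then S contains
-- the node {v}, the node other_v, and for each of the d_v − m remaining children a
-- summary tree with at least one node; hence d_v − m + 2 ≤ |S| ≤ K.
module Submission where

open import Defs
open import Data.Nat using (ℕ; suc; _+_; _≤_; s≤s; z≤n)
open import Data.Nat.Properties
open import Data.List using (length; _∷_)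
open import Relation.Binary.PropositionalEquality using (cong; sym)

1≤size : ∀ {t} (s : Summary t) → 1 ≤ size s
1≤size collapse   = s≤s z≤n
1≤size (expand _) = s≤s z≤n
1≤size (group _)  = s≤s z≤n

length≤count+sizeC : ∀ {ts n} (cs : Choices ts n) → length ts ≤ n + sizeC cs
length≤count+sizeC []         = z≤n
length≤count+sizeC (other cs) = s≤s (length≤count+sizeC cs)
length≤count+sizeC {_ ∷ ts} {n} (own s cs) = begin
  suc (length ts)         ≤⟨ s≤s (length≤count+sizeC cs) ⟩
  suc (n + sizeC cs)      ≡⟨ sym (+-suc n (sizeC cs)) ⟩
  n + suc (sizeC cs)      ≤⟨ +-monoʳ-≤ n (+-monoˡ-≤ (sizeC cs) (1≤size s)) ⟩
  n + (size s + sizeC cs) ∎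
  where open ≤-Reasoning

degree+2≤count+size-group : ∀ {ts m} (cs : Choices ts (suc m)) →
                            degree (node ts) + 2 ≤ suc m + size (group cs)
degree+2≤count+size-group {ts} {m} cs = begin
  length ts + 2             ≤⟨ +-monoˡ-≤ 2 (length≤count+sizeC cs) ⟩
  suc m + sizeC cs + 2      ≡⟨ +-assoc (suc m) (sizeC cs) 2 ⟩
  suc m + (sizeC cs + 2)    ≡⟨ cong (suc m +_) (+-comm (sizeC cs) 2) ⟩
  suc m + size (group cs)   ∎
  where open ≤-Reasoning

mutual
  degree+2≤count+size : ∀ {t} {S : Summary t} {v : Pos t} {m} → HasOther S v m →
                        degree (subtreeAt v) + 2 ≤ m + size S
  degree+2≤count+size {S = group cs} at-root = degree+2≤count+size-group cs
  degree+2≤count+size {m = m} (in-expand h) =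
    ≤-trans (degree+2≤count+sizeS h) (+-monoʳ-≤ m (n≤1+n _))
  degree+2≤count+size {m = m} (in-group h) =
    ≤-trans (degree+2≤count+sizeC h) (+-monoʳ-≤ m (m≤n+m _ 2))

  degree+2≤count+sizeS : ∀ {ts} {ss : Subs ts} {cp : ChildPos ts} {m} → SubsHas ss cp m →
                         degree (subtreeAtC cp) + 2 ≤ m + sizeS ss
  degree+2≤count+sizeS {ss = s ∷ ss} {m = m} (hd h) =
    ≤-trans (degree+2≤count+size h) (+-monoʳ-≤ m (m≤m+n (size s) (sizeS ss)))
  degree+2≤count+sizeS {ss = s ∷ ss} {m = m} (tl h) =
    ≤-trans (degree+2≤count+sizeS h) (+-monoʳ-≤ m (m≤n+m (sizeS ss) (size s)))

  degree+2≤count+sizeC : ∀ {ts n} {cs : Choices ts n} {cp : ChildPos ts} {m} → ChoicesHas cs cp m →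
                         degree (subtreeAtC cp) + 2 ≤ m + sizeC cs
  degree+2≤count+sizeC {cs = own s cs} {m = m} (hd-own h) =
    ≤-trans (degree+2≤count+size h) (+-monoʳ-≤ m (m≤m+n (size s) (sizeC cs)))
  degree+2≤count+sizeC (tl-other h) = degree+2≤count+sizeC h
  degree+2≤count+sizeC {cs = own s cs} {m = m} (tl-own h) =
    ≤-trans (degree+2≤count+sizeC h) (+-monoʳ-≤ m (m≤n+m (sizeC cs) (size s)))

theorem2 : (T : Tree) (K : ℕ) → 1 ≤ K → (S : Summary T) → size S ≤ K →
    (v : Pos T) (m : ℕ) → HasOther S v m →
    degree (subtreeAt v) + 2 ≤ m + K
theorem2 T K _ S size≤K v m h = ≤-trans (degree+2≤count+size h) (+-monoʳ-≤ m size≤K)
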